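{- Let $R$ be a set with $n$ elements, $0\le r\le n$ an integer, and $\mathcal S_r=\{X\subseteq R: |X|\le r\}$. Suppose that to each $X\in\mathcal S_r$ an event $[X]$ in some probability space is associated such that, for some numbers $p_0,\dots,p_r$, $$\bigwedge_{X\in\mathcal T}[X]=\Big[\bigcap_{X\in\mathcal T}X\Big]\ \text{ for every nonempty }\mathcal T\subseteq\mathcal S_r,\qquad \mathbb P([X])=p_{|X|}\ \text{ for every }X\in\mathcal S_r.$$ Then $$\mathbb P\Big(\bigvee_{X\in\mathcal S_r}[X]\Big)=\sum_{k=0}^r\alpha_kp_k,\qquad \alpha_k=(-1)^{r-k}\binom nk\binom{n-k-1}{r-k}.$$
   Context: Binomial conventions: $\binom ab=0$ if $b<0$ or $0\le a<b$, and $\binom{ -1}{0}=1$. -}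

module Defs where

open import Level using (Level; _⊔_)
open import Data.Nat as ℕ using (ℕ; zero; suc; _≤_; _∸_)
open import Data.Nat.Combinatorics using (_C_)
open import Data.Integer as ℤ using (ℤ; +_; -[1+_])
open import Data.List using (List; []; _∷_; _++_; map; foldr; filter)
open import Data.Vec using (Vec; []; _∷_)
open import Data.Fin.Subset using (Subset; _∩_; ∣_∣; inside; outside)
open import Algebra.Bundles using (CommutativeRing)
open import Algebra.Lattice.Bundles using (BooleanAlgebra)
import Algebra.Definitions.RawMonoid as RM

private variable c ℓ c′ ℓ′ : Level

-- Integer binomial coefficient C(a,b) for a ∈ ℤ, b ∈ ℕ:
-- for a ≥ 0 the usual one (so C(a,b)=0 when a<b), and for negative a the
-- generalized one C(-m-1,b) = (-1)^b C(m+b,b); in particular C(-1,0)=1.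
signPow : ℕ → ℤ
signPow zero = + 1
signPow (suc k) = ℤ.- signPow k

binomℤ : ℤ → ℕ → ℤ
binomℤ (+ a) b = + (a C b)
binomℤ -[1+ m ] b = signPow b ℤ.* + ((m ℕ.+ b) C b)

nk1 : ℕ → ℕ → ℤ
nk1 n k = (+ n ℤ.- + k) ℤ.- + 1

alpha : (n r k : ℕ) → ℤ
alpha n r k = signPow (r ∸ k) ℤ.* (+ (n C k) ℤ.* binomℤ (nk1 n k) (r ∸ k))

allSubsets : (n : ℕ) → List (Subset n)
allSubsets zero = [] ∷ []
allSubsets (suc n) = map (inside ∷_) (allSubsets n) ++ map (outside ∷_) (allSubsets n)

Sr : (n r : ℕ) → List (Subset n)
Sr n r = filter (λ X → ∣ X ∣ ℕ.≤? r) (allSubsets n)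

-- A finitely additive measure on a Boolean algebra of events with values
-- in a commutative ring (a probability measure into ℝ is an instance).
record Measure (B : BooleanAlgebra c ℓ) (A : CommutativeRing c′ ℓ′) : Set (c ⊔ ℓ ⊔ c′ ⊔ ℓ′) where
  module B = BooleanAlgebra B
  module A = CommutativeRing A
  field
    ℙ         : B.Carrier → A.Carrier
    ℙ-cong    : ∀ {x y} → x B.≈ y → ℙ x A.≈ ℙ y
    ℙ-additive : ∀ x y → (x B.∧ y) B.≈ B.⊥ → ℙ (x B.∨ y) A.≈ (ℙ x A.+ ℙ y)

module _ (A : CommutativeRing c′ ℓ′) where
  open CommutativeRing A
  open RM +-rawMonoid using (_×_)

  zmul : ℤ → Carrier → Carrier
  zmul (+ m) x = m × x
  zmul -[1+ m ] x = - (suc m × x)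

  sumTo : ℕ → (ℕ → Carrier) → Carrier
  sumTo zero f = f 0
  sumTo (suc r) f = sumTo r f + f (suc r)

module _ (B : BooleanAlgebra c ℓ) where
  open BooleanAlgebra B
  ⋁ : List Carrier → Carrier
  ⋁ = foldr _∨_ ⊥
  ⋀⁺ : Carrier → List Carrier → Carrier
  ⋀⁺ x xs = foldr _∧_ x xs

⋂⁺ : {n : ℕ} → Subset n → List (Subset n) → Subset n
⋂⁺ X Xs = foldr _∩_ X Xs

-- Split the subsets of an (n + 1)-set by whether they contain the new point.
-- The join over 𝒮_{r+1} is V ∨ U, where V gathers the events of the sets
-- containing the point (a system on n points with bound r and weights p ∘ suc)
-- and U those of the sets avoiding it (bound r + 1, weights p).  Closure under
-- meets makes [X] ≤ [Y] whenever X ⊆ Y, so V ∧ U is W, the join over the sets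
-- avoiding the point of size at most r.  Inclusion–exclusion
-- ℙ(V ∨ U) = ℙV + ℙU − ℙW and induction on n reduce the claim to
--   α(n+1, r+1, k) = α(n, r+1, k) + α(n, r, k−1) − α(n, r, k),
-- which is Pascal's rule applied to both binomial factors of α.
module Submission where

open import Defs
open import Function using (_∘_; id; _⇔_; Equivalence; mk⇔)
open import Data.Bool using (true; false)
open import Data.Nat as ℕ using (ℕ; zero; suc; _≤_; _∸_; s≤s; z≤n)
import Data.Nat.Properties as ℕ
open import Data.Nat.Combinatorics using (_C_; nCn≡1; nCk+nC[k+1]≡[n+1]C[k+1])
open import Data.Integer as ℤ using (ℤ; +_; -[1+_]; _⊖_)
import Data.Integer.Properties as ℤ
open import Data.Integer.Tactic.RingSolver using (solve-∀)
open import Data.List using (List; []; _∷_; _++_; map; filter)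
open import Data.List.Properties using (map-++; map-∘; filter-++; filter-accept; filter-reject; filter-none)
open import Data.List.Relation.Unary.All as All using (All; []; _∷_)
import Data.List.Relation.Unary.All.Properties as All
open import Data.List.Relation.Unary.Any using (here; there)
open import Data.List.Membership.Propositional using (_∈_)
open import Data.List.Membership.Propositional.Properties using (∈-map⁺; ∈-++⁺ˡ; ∈-++⁺ʳ; ∈-filter⁺)
open import Data.Vec using ([]; _∷_)
open import Data.Fin.Subset using (Subset; ∣_∣; inside; outside; _∩_)
open import Data.Fin.Subset.Properties using (∩-idem; ∣p∩q∣≤∣q∣)
open import Data.Maybe using (nothing)
open import Relation.Nullary using (yes; no)
open import Relation.Unary using (Pred; Decidable)
open import Relation.Binary.PropositionalEquality as ≡ using (_≡_)
open import Algebra.Bundles using (CommutativeRing)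
open import Algebra.Lattice.Bundles using (BooleanAlgebra)
open import Tactic.RingSolver.Core.AlmostCommutativeRing using (fromCommutativeRing)
import Relation.Binary.Lattice.Bundles as OrderTheoretic

module _ {a b p q} {A : Set a} {B : Set b} {P : Pred A p} {Q : Pred B q}
         (P? : Decidable P) (Q? : Decidable Q) (f : A → B) (P⇔Q∘f : ∀ x → P x ⇔ Q (f x)) where

  filter-map : ∀ xs → filter Q? (map f xs) ≡ map f (filter P? xs)
  filter-map [] = ≡.refl
  filter-map (x ∷ xs) with P? x
  ... | yes px =
    ≡.trans (filter-accept Q? (Equivalence.to (P⇔Q∘f x) px)) (≡.cong (f x ∷_) (filter-map xs))
  ... | no ¬px = ≡.trans (filter-reject Q? (¬px ∘ Equivalence.from (P⇔Q∘f x))) (filter-map xs)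

module BooleanAlgebraProperties {c ℓ} (B : BooleanAlgebra c ℓ) where
  open BooleanAlgebra B
  open import Algebra.Lattice.Properties.BooleanAlgebra B using (∧-zeroˡ; ∧-zeroʳ; ∧-identityˡ; ∨-identityˡ)
  open import Algebra.Lattice.Properties.Lattice lattice using (∨-∧-orderTheoreticLattice)
  open OrderTheoretic.Lattice ∨-∧-orderTheoreticLattice public
    using (x≤x∨y; y≤x∨y; ∨-least; ∧-greatest)
    renaming (_≤_ to _⊑_; trans to ⊑-trans; antisym to ⊑-antisym; ≤-respˡ-≈ to ⊑-respˡ-≈)
  open import Relation.Binary.Reasoning.Setoid setoid

  ∧-∨-¬∧ : ∀ x y → (x ∧ y) ∨ (¬ x ∧ y) ≈ y
  ∧-∨-¬∧ x y = begin
    (x ∧ y) ∨ (¬ x ∧ y)   ≈⟨ ∧-distribʳ-∨ y x (¬ x) ⟨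
    (x ∨ ¬ x) ∧ y         ≈⟨ ∧-cong (∨-complementʳ x) refl ⟩
    ⊤ ∧ y                 ≈⟨ ∧-identityˡ y ⟩
    y                     ∎

  ∧-¬∧-disjoint : ∀ x y → (x ∧ y) ∧ (¬ x ∧ y) ≈ ⊥
  ∧-¬∧-disjoint x y = begin
    (x ∧ y) ∧ (¬ x ∧ y)   ≈⟨ ∧-cong (∧-comm x y) refl ⟩
    (y ∧ x) ∧ (¬ x ∧ y)   ≈⟨ ∧-assoc y x (¬ x ∧ y) ⟩
    y ∧ (x ∧ (¬ x ∧ y))   ≈⟨ ∧-cong refl (∧-assoc x (¬ x) y) ⟨
    y ∧ ((x ∧ ¬ x) ∧ y)   ≈⟨ ∧-cong refl (∧-cong (∧-complementʳ x) refl) ⟩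
    y ∧ (⊥ ∧ y)           ≈⟨ ∧-cong refl (∧-zeroˡ y) ⟩
    y ∧ ⊥                 ≈⟨ ∧-zeroʳ y ⟩
    ⊥                     ∎

  ¬∧-∨ : ∀ x y → ¬ x ∧ (x ∨ y) ≈ ¬ x ∧ y
  ¬∧-∨ x y = begin
    ¬ x ∧ (x ∨ y)          ≈⟨ ∧-distribˡ-∨ (¬ x) x y ⟩
    (¬ x ∧ x) ∨ (¬ x ∧ y)  ≈⟨ ∨-cong (∧-complementˡ x) refl ⟩
    ⊥ ∨ (¬ x ∧ y)          ≈⟨ ∨-identityˡ (¬ x ∧ y) ⟩
    ¬ x ∧ y                ∎

  ⋁-++ : ∀ xs ys → ⋁ B (xs ++ ys) ≈ ⋁ B xs ∨ ⋁ B ys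
  ⋁-++ [] ys = sym (∨-identityˡ (⋁ B ys))
  ⋁-++ (x ∷ xs) ys = begin
    x ∨ ⋁ B (xs ++ ys)        ≈⟨ ∨-cong refl (⋁-++ xs ys) ⟩
    x ∨ (⋁ B xs ∨ ⋁ B ys)     ≈⟨ ∨-assoc x _ _ ⟨
    (x ∨ ⋁ B xs) ∨ ⋁ B ys     ∎

  ⋁-upper : ∀ {x xs} → x ∈ xs → x ⊑ ⋁ B xs
  ⋁-upper (here ≡.refl) = x≤x∨y _ _
  ⋁-upper (there x∈xs) = ⊑-trans (⋁-upper x∈xs) (y≤x∨y _ _)

  ⊥-least : ∀ {x} → ⊥ ⊑ x
  ⊥-least {x} = sym (∧-zeroˡ x)

  ⋁-least : ∀ {xs u} → All (_⊑ u) xs → ⋁ B xs ⊑ u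
  ⋁-least [] = ⊥-least
  ⋁-least (x⊑u ∷ xs⊑u) = ∨-least x⊑u (⋁-least xs⊑u)

  ⋁-∧-least : ∀ {xs u w} → All (λ x → x ∧ u ⊑ w) xs → ⋁ B xs ∧ u ⊑ w
  ⋁-∧-least {u = u} [] = ⊑-respˡ-≈ (sym (∧-zeroˡ u)) ⊥-least
  ⋁-∧-least {x ∷ xs} {u} (x∧u⊑w ∷ rest) =
    ⊑-respˡ-≈ (sym (∧-distribʳ-∨ u x (⋁ B xs))) (∨-least x∧u⊑w (⋁-∧-least rest))

module InclusionExclusion {c ℓ c′ ℓ′} {B : BooleanAlgebra c ℓ} {A : CommutativeRing c′ ℓ′}
                          (M : Measure B A) where
  open BooleanAlgebra B using (_∧_; _∨_; ¬_; ∧-absorbs-∨) renaming (sym to B-sym)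
  open BooleanAlgebraProperties B using (∧-∨-¬∧; ∧-¬∧-disjoint; ¬∧-∨)
  open CommutativeRing A
  open Measure M using (ℙ; ℙ-cong; ℙ-additive)
  -- Without decidable equality on A this solver cannot cancel x - x, so cancellations are done by hand.
  open import Tactic.RingSolver.NonReflective (fromCommutativeRing A (λ _ → nothing))
  open import Relation.Binary.Reasoning.Setoid setoid

  ℙ-split : ∀ x y → ℙ y ≈ ℙ (x ∧ y) + ℙ (¬ x ∧ y)
  ℙ-split x y =
    trans (ℙ-cong (B-sym (∧-∨-¬∧ x y))) (ℙ-additive (x ∧ y) (¬ x ∧ y) (∧-¬∧-disjoint x y))

  ℙ-∨-∧ : ∀ x y → ℙ (x ∨ y) ≈ ℙ x + ℙ y - ℙ (x ∧ y)
  ℙ-∨-∧ x y = begin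
    ℙ (x ∨ y)                                    ≈⟨ ℙ-split x (x ∨ y) ⟩
    ℙ (x ∧ (x ∨ y)) + ℙ (¬ x ∧ (x ∨ y))
      ≈⟨ +-cong (ℙ-cong (∧-absorbs-∨ x y)) (ℙ-cong (¬∧-∨ x y)) ⟩
    ℙ x + ℙ (¬ x ∧ y)                            ≈⟨ +-identityʳ _ ⟨
    (ℙ x + ℙ (¬ x ∧ y)) + 0#                     ≈⟨ +-congˡ (-‿inverseʳ (ℙ (x ∧ y))) ⟨
    (ℙ x + ℙ (¬ x ∧ y)) + (ℙ (x ∧ y) - ℙ (x ∧ y))
      ≈⟨ solve 3 (λ a t m → ((a ⊕ t) ⊕ (m ⊕ ⊝ m)) ⊜ (a ⊕ (m ⊕ t) ⊕ ⊝ m)) refl _ _ _ ⟩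
    ℙ x + (ℙ (x ∧ y) + ℙ (¬ x ∧ y)) - ℙ (x ∧ y)  ≈⟨ +-congʳ (+-congˡ (ℙ-split x y)) ⟨
    ℙ x + ℙ y - ℙ (x ∧ y)                        ∎

module IntegerMultiples {c ℓ} (A : CommutativeRing c ℓ) where
  open CommutativeRing A
  open import Algebra.Properties.Monoid.Mult +-monoid using (_×_; ×-homo-+)
  open import Algebra.Properties.Ring ring using (-0#≈0#; -‿involutive)
  open import Tactic.RingSolver.NonReflective (fromCommutativeRing A (λ _ → nothing))
  open import Relation.Binary.Reasoning.Setoid setoid

  zmul-⊖ : ∀ m k x → zmul A (m ⊖ k) x ≈ m × x - k × x
  zmul-⊖ m zero x = sym (trans (+-congˡ -0#≈0#) (+-identityʳ (m × x)))
  zmul-⊖ zero (suc k) x = sym (+-identityˡ (- (suc k × x)))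
  zmul-⊖ (suc m) (suc k) x = begin
    zmul A (suc m ⊖ suc k) x   ≡⟨ ≡.cong (λ z → zmul A z x) (ℤ.[1+m]⊖[1+n]≡m⊖n m k) ⟩
    zmul A (m ⊖ k) x           ≈⟨ zmul-⊖ m k x ⟩
    m × x - k × x              ≈⟨ +-identityˡ _ ⟨
    0# + (m × x - k × x)       ≈⟨ +-congʳ (-‿inverseʳ x) ⟨
    (x - x) + (m × x - k × x)
      ≈⟨ solve 3 (λ x u v → ((x ⊕ ⊝ x) ⊕ (u ⊕ ⊝ v)) ⊜ ((x ⊕ u) ⊕ ⊝ (x ⊕ v))) refl _ _ _ ⟩
    (x + m × x) - (x + k × x)  ∎

  zmul-+ : ∀ a b x → zmul A (a ℤ.+ b) x ≈ zmul A a x + zmul A b x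
  zmul-+ (+ m) (+ k) x = ×-homo-+ x m k
  zmul-+ (+ m) -[1+ k ] x = zmul-⊖ m (suc k) x
  zmul-+ -[1+ m ] (+ k) x = trans (zmul-⊖ k (suc m) x) (+-comm (k × x) _)
  zmul-+ -[1+ m ] -[1+ k ] x = begin
    - (suc (suc (m ℕ.+ k)) × x)       ≡⟨ ≡.cong (λ t → - (suc t × x)) (ℕ.+-suc m k) ⟨
    - ((suc m ℕ.+ suc k) × x)         ≈⟨ -‿cong (×-homo-+ x (suc m) (suc k)) ⟩
    - (suc m × x + suc k × x)         ≈⟨ solve 2 (λ u v → (⊝ (u ⊕ v)) ⊜ (⊝ u ⊕ ⊝ v)) refl _ _ ⟩
    - (suc m × x) + - (suc k × x)     ∎

  zmul-congˡ : ∀ {a b} x → a ≡ b → zmul A a x ≈ zmul A b x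
  zmul-congˡ x a≡b = reflexive (≡.cong (λ z → zmul A z x) a≡b)

  zmul-neg : ∀ a x → zmul A (ℤ.- a) x ≈ - zmul A a x
  zmul-neg (+ zero) x = sym -0#≈0#
  zmul-neg (+ suc m) x = refl
  zmul-neg -[1+ m ] x = sym (-‿involutive (suc m × x))

  zmul-sub : ∀ a b x → zmul A (a ℤ.- b) x ≈ zmul A a x - zmul A b x
  zmul-sub a b x = trans (zmul-+ a (ℤ.- b) x) (+-congˡ (zmul-neg b x))

module FiniteSums {c ℓ} (A : CommutativeRing c ℓ) where
  open CommutativeRing A
  open import Tactic.RingSolver.NonReflective (fromCommutativeRing A (λ _ → nothing))
  open import Relation.Binary.Reasoning.Setoid setoid

  -- Summation by parts for d k = a k + b (k - 1) - c k, read with b (-1) = c (r + 1) = 0.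
  sumTo-shift-split : ∀ r (d a b c : ℕ → Carrier) →
    d 0 ≈ a 0 - c 0 →
    (∀ j → suc j ≤ r → d (suc j) ≈ a (suc j) + b j - c (suc j)) →
    d (suc r) ≈ a (suc r) + b r →
    sumTo A (suc r) d ≈ sumTo A r b + sumTo A (suc r) a - sumTo A r c
  sumTo-shift-split r d a b c first middle last = begin
    sumTo A r d + d (suc r)                          ≈⟨ +-congˡ last ⟩
    sumTo A r d + (a (suc r) + b r)
      ≈⟨ solve 3 (λ s x y → (s ⊕ (x ⊕ y)) ⊜ ((s ⊕ y) ⊕ x)) refl _ _ _ ⟩
    (sumTo A r d + b r) + a (suc r)                  ≈⟨ +-congʳ (partial r ℕ.≤-refl) ⟩
    (sumTo A r b + sumTo A r a - sumTo A r c) + a (suc r)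
      ≈⟨ solve 4 (λ sb sa sc x → ((sb ⊕ sa ⊕ ⊝ sc) ⊕ x) ⊜ (sb ⊕ (sa ⊕ x) ⊕ ⊝ sc)) refl _ _ _ _ ⟩
    sumTo A r b + sumTo A (suc r) a - sumTo A r c    ∎
    where
    partial : ∀ m → m ≤ r → sumTo A m d + b m ≈ sumTo A m b + sumTo A m a - sumTo A m c
    partial zero _ = begin
      d 0 + b 0           ≈⟨ +-congʳ first ⟩
      (a 0 - c 0) + b 0   ≈⟨ solve 3 (λ x y z → ((x ⊕ ⊝ z) ⊕ y) ⊜ (y ⊕ x ⊕ ⊝ z)) refl _ _ _ ⟩
      b 0 + a 0 - c 0     ∎
    partial (suc m) m<r = begin
      (sumTo A m d + d (suc m)) + b (suc m)
        ≈⟨ +-congʳ (+-congˡ (middle m m<r)) ⟩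
      (sumTo A m d + (a (suc m) + b m - c (suc m))) + b (suc m)
        ≈⟨ solve 5 (λ s x y z w → ((s ⊕ (x ⊕ y ⊕ ⊝ z)) ⊕ w) ⊜ ((s ⊕ y) ⊕ (x ⊕ ⊝ z ⊕ w)))
                   refl _ _ _ _ _ ⟩
      (sumTo A m d + b m) + (a (suc m) - c (suc m) + b (suc m))
        ≈⟨ +-congʳ (partial m (ℕ.<⇒≤ m<r)) ⟩
      (sumTo A m b + sumTo A m a - sumTo A m c) + (a (suc m) - c (suc m) + b (suc m))
        ≈⟨ solve 6 (λ sb sa sc x z w → ((sb ⊕ sa ⊕ ⊝ sc) ⊕ (x ⊕ ⊝ z ⊕ w))
                                         ⊜ ((sb ⊕ w) ⊕ (sa ⊕ x) ⊕ ⊝ (sc ⊕ z)))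
                   refl _ _ _ _ _ _ ⟩
      sumTo A (suc m) b + sumTo A (suc m) a - sumTo A (suc m) c ∎

  sumTo-head : ∀ r (f : ℕ → Carrier) → (∀ j → f (suc j) ≈ 0#) → sumTo A r f ≈ f 0
  sumTo-head zero f _ = refl
  sumTo-head (suc r) f zeros = trans (+-cong (sumTo-head r f zeros) (zeros r)) (+-identityʳ (f 0))

module Coefficients where
  open import Data.Integer using (_+_; _*_; -_; _-_)
  open ≡ using (refl; cong; cong₂; sym; trans)
  open ≡.≡-Reasoning

  signPow-square : ∀ s → signPow s * signPow s ≡ + 1
  signPow-square zero = refl
  signPow-square (suc s) = trans (square-neg (signPow s)) (signPow-square s)
    where
    square-neg : ∀ a → (- a) * (- a) ≡ a * a
    square-neg = solve-∀

  binomℤ-zero : ∀ z → binomℤ z 0 ≡ + 1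
  binomℤ-zero (+ a) = refl
  binomℤ-zero -[1+ m ] = cong (λ t → + 1 * + (t C 0)) (ℕ.+-identityʳ m)

  C-pascalℤ : ∀ n k → + (suc n C suc k) ≡ + (n C k) + + (n C suc k)
  C-pascalℤ n k =
    trans (cong +_ (sym (nCk+nC[k+1]≡[n+1]C[k+1] n k))) (ℤ.pos-+ (n C k) (n C suc k))

  binomℤ-pascal : ∀ z s → binomℤ (z + + 1) (suc s) ≡ binomℤ z (suc s) + binomℤ z s
  binomℤ-pascal (+ a) s = begin
    + ((a ℕ.+ 1) C suc s)    ≡⟨ cong (λ t → + (t C suc s)) (ℕ.+-comm a 1) ⟩
    + (suc a C suc s)        ≡⟨ C-pascalℤ a s ⟩
    + (a C s) + + (a C suc s) ≡⟨ ℤ.+-comm (+ (a C s)) (+ (a C suc s)) ⟩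
    + (a C suc s) + + (a C s) ∎
  binomℤ-pascal -[1+ zero ] s = begin
    + 0                                            ≡⟨ sym (cancel (signPow s)) ⟩
    - signPow s * + 1 + signPow s * + 1
      ≡⟨ cong₂ (λ u v → - signPow s * + u + signPow s * + v) (sym (nCn≡1 (suc s))) (sym (nCn≡1 s)) ⟩
    - signPow s * + (suc s C suc s) + signPow s * + (s C s) ∎
    where
    cancel : ∀ x → - x * + 1 + x * + 1 ≡ + 0
    cancel = solve-∀
  binomℤ-pascal -[1+ suc m ] s = begin
    - σ * + (N C suc s)                                  ≡⟨ regroup σ (+ (N C s)) (+ (N C suc s)) ⟩
    - σ * (+ (N C s) + + (N C suc s)) + σ * + (N C s)
      ≡⟨ cong₂ (λ u v → - σ * u + σ * + (v C s)) (sym (C-pascalℤ N s)) (ℕ.+-suc m s) ⟩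
    - σ * + (suc N C suc s) + σ * + (suc (m ℕ.+ s) C s) ∎
    where
    σ = signPow s
    N = m ℕ.+ suc s
    regroup : ∀ x a b → - x * b ≡ - x * (a + b) + x * a
    regroup = solve-∀

  binomℤ-nk1-suc : ∀ n k s →
    binomℤ (nk1 (suc n) k) (suc s) ≡ binomℤ (nk1 n k) (suc s) + binomℤ (nk1 n k) s
  binomℤ-nk1-suc n k s =
    trans (cong (λ z → binomℤ z (suc s)) (shift (+ n) (+ k))) (binomℤ-pascal (nk1 n k) s)
    where
    shift : ∀ a b → (+ 1 + a - b) - + 1 ≡ ((a - b) - + 1) + + 1
    shift = solve-∀

  binomℤ-nk1-pred : ∀ n k s →
    binomℤ (nk1 n k) (suc s) ≡ binomℤ (nk1 n (suc k)) (suc s) + binomℤ (nk1 n (suc k)) s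
  binomℤ-nk1-pred n k s =
    trans (cong (λ z → binomℤ z (suc s)) (shift (+ n) (+ k))) (binomℤ-pascal (nk1 n (suc k)) s)
    where
    shift : ∀ a b → (a - b) - + 1 ≡ ((a - (+ 1 + b)) - + 1) + + 1
    shift = solve-∀

  -- alpha n r k unfolds to alpha′ n k (r ∸ k).
  alpha′ : ℕ → ℕ → ℕ → ℤ
  alpha′ n k s = signPow s * (+ (n C k) * binomℤ (nk1 n k) s)

  alpha′-zero-zero : ∀ n → alpha′ n 0 0 ≡ + 1
  alpha′-zero-zero n = cong (λ z → + 1 * (+ 1 * z)) (binomℤ-zero (nk1 n 0))

  alpha′-suc-zero-suc : ∀ n s → alpha′ (suc n) 0 (suc s) ≡ alpha′ n 0 (suc s) - alpha′ n 0 s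
  alpha′-suc-zero-suc n s = begin
    - σ * (+ 1 * binomℤ (nk1 (suc n) 0) (suc s))
                                                ≡⟨ cong (λ z → - σ * (+ 1 * z)) (binomℤ-nk1-suc n 0 s) ⟩
    - σ * (+ 1 * (P + Q))                       ≡⟨ expand σ P Q ⟩
    - σ * (+ 1 * P) - σ * (+ 1 * Q)             ∎
    where
    σ = signPow s
    P = binomℤ (nk1 n 0) (suc s)
    Q = binomℤ (nk1 n 0) s
    expand : ∀ x p q → - x * (+ 1 * (p + q)) ≡ - x * (+ 1 * p) - x * (+ 1 * q)
    expand = solve-∀

  alpha′-suc-suc-suc : ∀ n j s →
    alpha′ (suc n) (suc j) (suc s) ≡ alpha′ n (suc j) (suc s) + alpha′ n j (suc s) - alpha′ n (suc j) s
  alpha′-suc-suc-suc n j s = begin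
    alpha′ (suc n) (suc j) (suc s)
      ≡⟨ cong₂ (λ c z → - σ * (c * z)) (C-pascalℤ n j) (binomℤ-nk1-suc n (suc j) s) ⟩
    - σ * ((a + b) * (P + Q))
      ≡⟨ expand σ a b P Q ⟩
    - σ * (b * P) + - σ * (a * (P + Q)) - σ * (b * Q)
      ≡⟨ cong (λ z → - σ * (b * P) + - σ * (a * z) - σ * (b * Q)) (sym (binomℤ-nk1-pred n j s)) ⟩
    alpha′ n (suc j) (suc s) + alpha′ n j (suc s) - alpha′ n (suc j) s ∎
    where
    σ = signPow s
    a = + (n C j)
    b = + (n C suc j)
    P = binomℤ (nk1 n (suc j)) (suc s)
    Q = binomℤ (nk1 n (suc j)) s
    expand : ∀ x a b p q →
      - x * ((a + b) * (p + q)) ≡ - x * (b * p) + - x * (a * (p + q)) - x * (b * q)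
    expand = solve-∀

  alpha′-suc-suc-zero : ∀ n j → alpha′ (suc n) (suc j) 0 ≡ alpha′ n (suc j) 0 + alpha′ n j 0
  alpha′-suc-suc-zero n j = begin
    + 1 * (+ (suc n C suc j) * binomℤ (nk1 (suc n) (suc j)) 0)
      ≡⟨ cong₂ (λ c z → + 1 * (c * z)) (C-pascalℤ n j) (binomℤ-zero (nk1 (suc n) (suc j))) ⟩
    + 1 * ((a + b) * + 1)
      ≡⟨ expand a b ⟩
    + 1 * (b * + 1) + + 1 * (a * + 1)
      ≡⟨ cong₂ (λ u v → + 1 * (b * u) + + 1 * (a * v))
               (sym (binomℤ-zero (nk1 n (suc j)))) (sym (binomℤ-zero (nk1 n j))) ⟩
    alpha′ n (suc j) 0 + alpha′ n j 0 ∎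
    where
    a = + (n C j)
    b = + (n C suc j)
    expand : ∀ a b → + 1 * ((a + b) * + 1) ≡ + 1 * (b * + 1) + + 1 * (a * + 1)
    expand = solve-∀

  alpha-empty-zero : ∀ r → alpha 0 r 0 ≡ + 1
  alpha-empty-zero r = begin
    σ * (+ 1 * (σ * + (r C r))) ≡⟨ cong (λ t → σ * (+ 1 * (σ * + t))) (nCn≡1 r) ⟩
    σ * (+ 1 * (σ * + 1))       ≡⟨ simplify σ ⟩
    σ * σ                       ≡⟨ signPow-square r ⟩
    + 1                         ∎
    where
    σ = signPow r
    simplify : ∀ x → x * (+ 1 * (x * + 1)) ≡ x * x
    simplify = solve-∀

  alpha-empty-suc : ∀ r j → alpha 0 r (suc j) ≡ + 0
  alpha-empty-suc r j = ℤ.*-zeroʳ (signPow (r ∸ suc j))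

  alpha-suc-suc-suc : ∀ n r j → suc j ℕ.≤ r →
    alpha (suc n) (suc r) (suc j) ≡ alpha n (suc r) (suc j) + alpha n r j - alpha n r (suc j)
  alpha-suc-suc-suc n r j j<r with r ∸ j | ℕ.+-∸-assoc 1 j<r
  ... | .(suc (r ∸ suc j)) | refl = alpha′-suc-suc-suc n j (r ∸ suc j)

  alpha-suc-suc-diag : ∀ n r → alpha (suc n) (suc r) (suc r) ≡ alpha n (suc r) (suc r) + alpha n r r
  alpha-suc-suc-diag n r with r ∸ r | ℕ.n∸n≡0 r
  ... | .0 | refl = alpha′-suc-suc-zero n r

size≤? : ∀ {n} r → Decidable (λ (X : Subset n) → ∣ X ∣ ≤ r)
size≤? r X = ∣ X ∣ ℕ.≤? r

allSubsets-complete : ∀ {n} (X : Subset n) → X ∈ allSubsets n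
allSubsets-complete [] = here ≡.refl
allSubsets-complete (true ∷ X) = ∈-++⁺ˡ (∈-map⁺ (inside ∷_) (allSubsets-complete X))
allSubsets-complete {suc n} (false ∷ X) =
  ∈-++⁺ʳ (map (inside ∷_) (allSubsets n)) (∈-map⁺ (outside ∷_) (allSubsets-complete X))

Sr-complete : ∀ {n r} {X : Subset n} → ∣ X ∣ ≤ r → X ∈ Sr n r
Sr-complete {r = r} {X} ∣X∣≤r = ∈-filter⁺ (size≤? r) (allSubsets-complete X) ∣X∣≤r

Sr-bounded : ∀ n r → All (λ X → ∣ X ∣ ≤ r) (Sr n r)
Sr-bounded n r = All.all-filter (size≤? r) (allSubsets n)

Sr-suc : ∀ n r →
  Sr (suc n) r ≡ filter (size≤? r) (map (inside ∷_) (allSubsets n)) ++ map (outside ∷_) (Sr n r)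
Sr-suc n r = ≡.trans (filter-++ (size≤? r) (map (inside ∷_) (allSubsets n)) _)
  (≡.cong (filter (size≤? r) (map (inside ∷_) (allSubsets n)) ++_)
          (filter-map (size≤? r) (size≤? r) (outside ∷_) (λ _ → mk⇔ id id) (allSubsets n)))

Sr-suc-zero : ∀ n → Sr (suc n) 0 ≡ map (outside ∷_) (Sr n 0)
Sr-suc-zero n = ≡.trans (Sr-suc n 0)
  (≡.cong (_++ map (outside ∷_) (Sr n 0))
          (filter-none (size≤? 0) (All.map⁺ (All.universal (λ _ ()) (allSubsets n)))))

Sr-suc-suc : ∀ n r → Sr (suc n) (suc r) ≡ map (inside ∷_) (Sr n r) ++ map (outside ∷_) (Sr n (suc r))
Sr-suc-suc n r = ≡.trans (Sr-suc n (suc r))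
  (≡.cong (_++ map (outside ∷_) (Sr n (suc r)))
          (filter-map (size≤? r) (size≤? (suc r)) (inside ∷_) (λ _ → mk⇔ s≤s ℕ.s≤s⁻¹) (allSubsets n)))

module _ {c ℓ c′ ℓ′} (B : BooleanAlgebra c ℓ) (A : CommutativeRing c′ ℓ′) (M : Measure B A) where
  open BooleanAlgebra B
  open import Algebra.Lattice.Properties.BooleanAlgebra B using (∨-identityʳ)
  open BooleanAlgebraProperties B
  module A = CommutativeRing A
  open Measure M using (ℙ; ℙ-cong)
  open InclusionExclusion M using (ℙ-∨-∧)
  open IntegerMultiples A using (zmul-congˡ; zmul-+; zmul-sub)
  open FiniteSums A using (sumTo-shift-split; sumTo-head)
  open Coefficients

  IntersectionClosed : ∀ {n} → ℕ → (Subset n → Carrier) → Set ℓ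
  IntersectionClosed r ev = ∀ {X Y} → ∣ X ∣ ≤ r → ∣ Y ∣ ≤ r → ev X ∧ ev Y ≈ ev (X ∩ Y)

  SizeUniform : ∀ {n} → ℕ → (Subset n → Carrier) → (ℕ → A.Carrier) → Set ℓ′
  SizeUniform r ev p = ∀ {X} → ∣ X ∣ ≤ r → ℙ (ev X) A.≈ p ∣ X ∣

  IntersectionClosed-weaken : ∀ {n r} {ev : Subset n → Carrier} →
    IntersectionClosed (suc r) ev → IntersectionClosed r ev
  IntersectionClosed-weaken closed ∣X∣≤r ∣Y∣≤r =
    closed (ℕ.m≤n⇒m≤1+n ∣X∣≤r) (ℕ.m≤n⇒m≤1+n ∣Y∣≤r)

  IntersectionClosed-inside : ∀ {n r} {ev : Subset (suc n) → Carrier} →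
    IntersectionClosed (suc r) ev → IntersectionClosed r (ev ∘ (inside ∷_))
  IntersectionClosed-inside closed ∣X∣≤r ∣Y∣≤r = closed (s≤s ∣X∣≤r) (s≤s ∣Y∣≤r)

  SizeUniform-weaken : ∀ {n r} {ev : Subset n → Carrier} {p} →
    SizeUniform (suc r) ev p → SizeUniform r ev p
  SizeUniform-weaken uniform ∣X∣≤r = uniform (ℕ.m≤n⇒m≤1+n ∣X∣≤r)

  SizeUniform-inside : ∀ {n r} {ev : Subset (suc n) → Carrier} {p} →
    SizeUniform (suc r) ev p → SizeUniform r (ev ∘ (inside ∷_)) (p ∘ suc)
  SizeUniform-inside uniform ∣X∣≤r = uniform (s≤s ∣X∣≤r)

  alphaSum : ℕ → ℕ → (ℕ → A.Carrier) → A.Carrier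
  alphaSum n r p = sumTo A r (λ k → zmul A (alpha n r k) (p k))

  alphaSum-empty : ∀ r p → alphaSum 0 r p A.≈ p 0
  alphaSum-empty r p = A.trans (sumTo-head r _ (λ j → zmul-congˡ (p (suc j)) (alpha-empty-suc r j)))
                               (A.trans (zmul-congˡ (p 0) (alpha-empty-zero r)) (A.+-identityʳ (p 0)))

  alphaSum-suc-zero : ∀ n p → alphaSum (suc n) 0 p ≡ alphaSum n 0 p
  alphaSum-suc-zero n p =
    ≡.cong (λ z → zmul A z (p 0)) (≡.trans (alpha′-zero-zero (suc n)) (≡.sym (alpha′-zero-zero n)))

  alphaSum-suc-suc : ∀ n r p →
    alphaSum (suc n) (suc r) p A.≈ alphaSum n r (p ∘ suc) A.+ alphaSum n (suc r) p A.- alphaSum n r p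
  alphaSum-suc-suc n r p = sumTo-shift-split r
    (λ k → zmul A (alpha (suc n) (suc r) k) (p k)) (λ k → zmul A (alpha n (suc r) k) (p k))
    (λ j → zmul A (alpha n r j) (p (suc j))) (λ k → zmul A (alpha n r k) (p k))
    (A.trans (zmul-congˡ (p 0) (alpha′-suc-zero-suc n r)) (zmul-sub (alpha n (suc r) 0) (alpha n r 0) (p 0)))
    (λ j j<r → A.trans (zmul-congˡ (p (suc j)) (alpha-suc-suc-suc n r j j<r))
      (A.trans (zmul-sub (alpha n (suc r) (suc j) ℤ.+ alpha n r j) (alpha n r (suc j)) (p (suc j)))
               (A.+-congʳ (zmul-+ (alpha n (suc r) (suc j)) (alpha n r j) (p (suc j))))))
    (A.trans (zmul-congˡ (p (suc r)) (alpha-suc-suc-diag n r))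
             (zmul-+ (alpha n (suc r) (suc r)) (alpha n r r) (p (suc r))))

  module _ {n} (ev : Subset (suc n) → Carrier) where
    ⋁-Sr-suc-zero : ⋁ B (map ev (Sr (suc n) 0)) ≡ ⋁ B (map (ev ∘ (outside ∷_)) (Sr n 0))
    ⋁-Sr-suc-zero =
      ≡.cong (⋁ B) (≡.trans (≡.cong (map ev) (Sr-suc-zero n)) (≡.sym (map-∘ {g = ev} (Sr n 0))))

    ⋁-Sr-suc-suc : ∀ r →
      ⋁ B (map ev (Sr (suc n) (suc r)))
        ≈ ⋁ B (map (ev ∘ (inside ∷_)) (Sr n r)) ∨ ⋁ B (map (ev ∘ (outside ∷_)) (Sr n (suc r)))
    ⋁-Sr-suc-suc r = trans (reflexive (≡.cong (⋁ B) split))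
      (⋁-++ (map (ev ∘ (inside ∷_)) (Sr n r)) (map (ev ∘ (outside ∷_)) (Sr n (suc r))))
      where
      split : map ev (Sr (suc n) (suc r))
              ≡ map (ev ∘ (inside ∷_)) (Sr n r) ++ map (ev ∘ (outside ∷_)) (Sr n (suc r))
      split = ≡.trans (≡.cong (map ev) (Sr-suc-suc n r))
             (≡.trans (map-++ ev (map (inside ∷_) (Sr n r)) (map (outside ∷_) (Sr n (suc r))))
                      (≡.sym (≡.cong₂ _++_ (map-∘ {g = ev} (Sr n r)) (map-∘ {g = ev} (Sr n (suc r))))))

    ⋁-inside-∧-⋁-outside : ∀ {r} → IntersectionClosed (suc r) ev →
      ⋁ B (map (ev ∘ (inside ∷_)) (Sr n r)) ∧ ⋁ B (map (ev ∘ (outside ∷_)) (Sr n (suc r)))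
        ≈ ⋁ B (map (ev ∘ (outside ∷_)) (Sr n r))
    ⋁-inside-∧-⋁-outside {r} closed = ⊑-antisym
      (⋁-∧-least (All.map⁺ (All.map inside∧U⊑W (Sr-bounded n r))))
      (⋁-least (All.map⁺ (All.map outside⊑V∧U (Sr-bounded n r))))
      where
      V = ⋁ B (map (ev ∘ (inside ∷_)) (Sr n r))
      U = ⋁ B (map (ev ∘ (outside ∷_)) (Sr n (suc r)))
      W = ⋁ B (map (ev ∘ (outside ∷_)) (Sr n r))
      inside∧U⊑W : ∀ {X} → ∣ X ∣ ≤ r → ev (inside ∷ X) ∧ U ⊑ W
      inside∧U⊑W {X} ∣X∣≤r = ⊑-respˡ-≈ (∧-comm _ _)
        (⋁-∧-least (All.map⁺ (All.map outside∧inside⊑W (Sr-bounded n (suc r)))))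
        where
        outside∧inside⊑W : ∀ {Y} → ∣ Y ∣ ≤ suc r → ev (outside ∷ Y) ∧ ev (inside ∷ X) ⊑ W
        outside∧inside⊑W {Y} ∣Y∣≤r+1 = ⊑-respˡ-≈ (sym (closed ∣Y∣≤r+1 (s≤s ∣X∣≤r)))
          (⋁-upper (∈-map⁺ (ev ∘ (outside ∷_))
                             (Sr-complete (ℕ.≤-trans (∣p∩q∣≤∣q∣ Y X) ∣X∣≤r))))
      outside⊑V∧U : ∀ {Z} → ∣ Z ∣ ≤ r → ev (outside ∷ Z) ⊑ V ∧ U
      outside⊑V∧U {Z} ∣Z∣≤r = ∧-greatest
        (⊑-trans outside⊑inside (⋁-upper (∈-map⁺ (ev ∘ (inside ∷_)) (Sr-complete ∣Z∣≤r))))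
        (⋁-upper (∈-map⁺ (ev ∘ (outside ∷_)) (Sr-complete (ℕ.m≤n⇒m≤1+n ∣Z∣≤r))))
        where
        outside⊑inside : ev (outside ∷ Z) ⊑ ev (inside ∷ Z)
        outside⊑inside = sym (trans (closed (ℕ.m≤n⇒m≤1+n ∣Z∣≤r) (s≤s ∣Z∣≤r))
                                    (reflexive (≡.cong (ev ∘ (outside ∷_)) (∩-idem Z))))

  ℙ-⋁-Sr : ∀ n r (ev : Subset n → Carrier) (p : ℕ → A.Carrier) →
    IntersectionClosed r ev → SizeUniform r ev p → ℙ (⋁ B (map ev (Sr n r))) A.≈ alphaSum n r p
  ℙ-⋁-Sr zero r ev p closed uniform =
    -- Sr 0 r computes to [] ∷ [].
    A.trans (ℙ-cong (∨-identityʳ (ev []))) (A.trans (uniform z≤n) (A.sym (alphaSum-empty r p)))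
  ℙ-⋁-Sr (suc n) zero ev p closed uniform = begin
    ℙ (⋁ B (map ev (Sr (suc n) 0)))              ≡⟨ ≡.cong ℙ (⋁-Sr-suc-zero ev) ⟩
    ℙ (⋁ B (map (ev ∘ (outside ∷_)) (Sr n 0)))  ≈⟨ ℙ-⋁-Sr n 0 (ev ∘ (outside ∷_)) p closed uniform ⟩
    alphaSum n 0 p                              ≡⟨ alphaSum-suc-zero n p ⟨
    alphaSum (suc n) 0 p                        ∎
    where open import Relation.Binary.Reasoning.Setoid A.setoid
  ℙ-⋁-Sr (suc n) (suc r) ev p closed uniform = begin
    ℙ (⋁ B (map ev (Sr (suc n) (suc r))))    ≈⟨ ℙ-cong (⋁-Sr-suc-suc ev r) ⟩
    ℙ (V ∨ U)                                ≈⟨ ℙ-∨-∧ V U ⟩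
    ℙ V A.+ ℙ U A.- ℙ (V ∧ U)                ≈⟨ A.+-cong (A.+-cong ℙV ℙU) (A.-‿cong ℙV∧U) ⟩
    alphaSum n r (p ∘ suc) A.+ alphaSum n (suc r) p A.- alphaSum n r p
                                             ≈⟨ alphaSum-suc-suc n r p ⟨
    alphaSum (suc n) (suc r) p               ∎
    where
    open import Relation.Binary.Reasoning.Setoid A.setoid
    V = ⋁ B (map (ev ∘ (inside ∷_)) (Sr n r))
    U = ⋁ B (map (ev ∘ (outside ∷_)) (Sr n (suc r)))
    ℙV = ℙ-⋁-Sr n r (ev ∘ (inside ∷_)) (p ∘ suc) (IntersectionClosed-inside {ev = ev} closed)
                                                 (SizeUniform-inside {ev = ev} {p} uniform)
    ℙU = ℙ-⋁-Sr n (suc r) (ev ∘ (outside ∷_)) p closed uniform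
    ℙV∧U = A.trans (ℙ-cong (⋁-inside-∧-⋁-outside ev closed))
      (ℙ-⋁-Sr n r (ev ∘ (outside ∷_)) p (IntersectionClosed-weaken {ev = ev ∘ (outside ∷_)} closed)
                                        (SizeUniform-weaken {ev = ev ∘ (outside ∷_)} {p} uniform))

lemmaA2 : ∀ {c ℓ c′ ℓ′} (B : BooleanAlgebra c ℓ) (A : CommutativeRing c′ ℓ′)
    (M : Measure B A) (n r : ℕ) → r ≤ n →
    (ev : Subset n → BooleanAlgebra.Carrier B) →
    (p : ℕ → CommutativeRing.Carrier A) →
    (∀ (X : Subset n) (Xs : List (Subset n)) → ∣ X ∣ ≤ r → All (λ Y → ∣ Y ∣ ≤ r) Xs →
      BooleanAlgebra._≈_ B (⋀⁺ B (ev X) (map ev Xs)) (ev (⋂⁺ X Xs))) →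
    (∀ (X : Subset n) → ∣ X ∣ ≤ r →
      CommutativeRing._≈_ A (Measure.ℙ M (ev X)) (p ∣ X ∣)) →
    CommutativeRing._≈_ A (Measure.ℙ M (⋁ B (map ev (Sr n r))))
      (sumTo A r (λ k → zmul A (alpha n r k) (p k)))
lemmaA2 B A M n r _ ev p meets probabilities =
  ℙ-⋁-Sr B A M n r ev p
    (λ {X} {Y} ∣X∣≤r ∣Y∣≤r → meets Y (X ∷ []) ∣Y∣≤r (∣X∣≤r ∷ []))
    (λ {X} → probabilities X)
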